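{- For every integer $n\geq 1$, $$\sum_{k=1}^n H_k(1)H_k(1,1)=(n+1)H_n(1)H_n(1,1)+(3n+1)\left(H_n(1)-\tfrac{1}{2}H_n(1)^2\right)+\tfrac{n+1}{2}H_n(2)-3n.$$
   Context: For a vector $\mathbf{s}=(s_1,\dots,s_d)$ of positive integers and $n\geq 0$, the multiple harmonic sum is $H_n(\mathbf{s})=\sum_{1\leq k_1<k_2<\cdots<k_d\leq n}\frac{1}{k_1^{s_1}k_2^{s_2}\cdots k_d^{s_d}}$. Thus $H_n(1)=\sum_{k=1}^n 1/k$, $H_n(2)=\sum_{k=1}^n 1/k^2$, and $H_n(1,1)=\sum_{1\le i<j\le n}\frac{1}{ij}$. -}

module Defs where

open import Data.Nat using (ℕ; zero; suc; _^_; _∸_; NonZero)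
import Data.Nat as ℕ
open import Data.Nat.Properties using (m^n≢0)
open import Data.List using (List; []; _∷_)
open import Data.Integer using (+_)
open import Data.Rational using (ℚ; 0ℚ; 1ℚ; _+_; _*_; _/_)

sumTo : ℕ → (ℕ → ℚ) → ℚ
sumTo zero    f = 0ℚ
sumTo (suc n) f = sumTo n f + f (suc n)

-- Σ_{k=m+1}^{n} f k  (empty if n ≤ m)
sumBetween : ℕ → ℕ → (ℕ → ℚ) → ℚ
sumBetween m n f = sumTo (n ∸ m) (λ i → f (m ℕ.+ i))

invPowSuc : ℕ → ℕ → ℚ
invPowSuc j s = (+ 1) / (suc j ^ s)
  where instance
    nz : NonZero (suc j ^ s)
    nz = m^n≢0 (suc j) s

-- 1 / k^s, where k = 0 never occurs below (indices k ≥ 1)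
invPow : ℕ → ℕ → ℚ
invPow zero    s = 0ℚ
invPow (suc j) s = invPowSuc j s

-- tail sum:  Σ_{m < k_1 < ... < k_d ≤ n} 1/(k_1^{s_1} ... k_d^{s_d})
tailSum : ℕ → ℕ → List ℕ → ℚ
tailSum m n []       = 1ℚ
tailSum m n (s ∷ ss) = sumBetween m n (λ k → invPow k s * tailSum k n ss)

H : ℕ → List ℕ → ℚ
H n s = tailSum 0 n s

-- The proof is an induction on n driven by three recurrences, all read off
-- from the definition of H by splitting off the last summand k = n+1:
--   H_{n+1}(s)   = H_n(s) + 1/(n+1)^s,
--   H_{n+1}(s,t) = H_n(s,t) + H_n(s) / (n+1)^t,
-- together with the "stuffle" relation H_n(s)² = H_n(2s) + 2 H_n(s,s).
-- Writing the right-hand side as a polynomial  closedForm N a b c  in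
-- N = n, a = H_n(1), b = H_n(1,1), c = H_n(2), the induction step is the
-- polynomial identity  closedForm-increment, which shows that the increment of
-- the closed form is  H_{n+1}(1) H_{n+1}(1,1)  modulo the two relations
-- (n+1) · 1/(n+1) = 1  and  a² = c + 2b.

module Submission where

open import Defs
open import Data.Nat using (ℕ; suc)
open import Data.List using (_∷_; [])
open import Data.Integer using (+_)
open import Relation.Binary.PropositionalEquality using (_≡_)
import Data.Nat
open import Data.Rational using (ℚ; _+_; _*_; _-_; _/_; ½)

open import Data.Nat using (zero; _∸_; NonZero)
import Data.Nat as ℕ
import Data.Nat.Properties as ℕP
open import Data.Nat.Tactic.RingSolver using (solve-∀)
import Data.Integer as ℤ
import Data.Integer.Properties as ℤP
open import Data.Rational using (0ℚ; 1ℚ; fromℚᵘ)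
import Data.Rational.Properties as QP
import Data.Rational.Unnormalised as ℚᵘ
import Data.Rational.Unnormalised.Properties as ℚᵘP
import Data.Rational.Solver
open import Algebra.Bundles using (CommutativeMonoid)
import Algebra.Properties.CommutativeSemigroup as CommSemigroupProperties
open import Relation.Binary.PropositionalEquality using (refl; sym; trans; cong; cong₂; module ≡-Reasoning)

module ℚ-Solver = Data.Rational.Solver.+-*-Solver

-- Normalisation  fromℚᵘ : ℚᵘ → ℚ  commutes with + and *.  Since  i / suc d
-- is by definition  fromℚᵘ (mkℚᵘ i d),  this is how sums and products of
-- fractions are computed below.
fromℚᵘ-homo-+ : ∀ p q → fromℚᵘ p + fromℚᵘ q ≡ fromℚᵘ (p ℚᵘ.+ q)
fromℚᵘ-homo-+ p q = QP.toℚᵘ-injective (ℚᵘP.≃-trans (QP.toℚᵘ-homo-+ (fromℚᵘ p) (fromℚᵘ q))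
  (ℚᵘP.≃-trans (ℚᵘP.+-cong (QP.toℚᵘ-fromℚᵘ p) (QP.toℚᵘ-fromℚᵘ q)) (ℚᵘP.≃-sym (QP.toℚᵘ-fromℚᵘ (p ℚᵘ.+ q)))))

fromℚᵘ-homo-* : ∀ p q → fromℚᵘ p * fromℚᵘ q ≡ fromℚᵘ (p ℚᵘ.* q)
fromℚᵘ-homo-* p q = QP.toℚᵘ-injective (ℚᵘP.≃-trans (QP.toℚᵘ-homo-* (fromℚᵘ p) (fromℚᵘ q))
  (ℚᵘP.≃-trans (ℚᵘP.*-cong (QP.toℚᵘ-fromℚᵘ p) (QP.toℚᵘ-fromℚᵘ q)) (ℚᵘP.≃-sym (QP.toℚᵘ-fromℚᵘ (p ℚᵘ.* q)))))

/-≡ : ∀ a b m n .{{_ : NonZero m}} .{{_ : NonZero n}} → a ℕ.* n ≡ b ℕ.* m → (+ a) / m ≡ (+ b) / n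
/-≡ a b (suc m) (suc n) e = QP.fromℚᵘ-cong {ℚᵘ.mkℚᵘ (+ a) m} {ℚᵘ.mkℚᵘ (+ b) n} (ℚᵘ.*≡* (trans (sym (ℤP.pos-* a (suc n))) (trans (cong +_ e) (ℤP.pos-* b (suc m)))))

/-* : ∀ a b m n .{{_ : NonZero m}} .{{_ : NonZero n}} →
      ((+ a) / m) * ((+ b) / n) ≡ _/_ (+ (a ℕ.* b)) (m ℕ.* n) {{ℕP.m*n≢0 m n}}
/-* a b (suc m) (suc n) = trans (fromℚᵘ-homo-* (ℚᵘ.mkℚᵘ (+ a) m) (ℚᵘ.mkℚᵘ (+ b) n)) (QP./-cong (sym (ℤP.pos-* a b)) refl)

/-+ : ∀ a b m n .{{_ : NonZero m}} .{{_ : NonZero n}} →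
      ((+ a) / m) + ((+ b) / n) ≡ _/_ (+ (a ℕ.* n ℕ.+ b ℕ.* m)) (m ℕ.* n) {{ℕP.m*n≢0 m n}}
/-+ a b (suc m) (suc n) = trans (fromℚᵘ-homo-+ (ℚᵘ.mkℚᵘ (+ a) m) (ℚᵘ.mkℚᵘ (+ b) n)) (QP./-cong numerator refl)
  where
  numerator : (+ a) ℤ.* (+ suc n) ℤ.+ (+ b) ℤ.* (+ suc m) ≡ + (a ℕ.* suc n ℕ.+ b ℕ.* suc m)
  numerator = sym (trans (ℤP.pos-+ (a ℕ.* suc n) (b ℕ.* suc m)) (cong₂ ℤ._+_ (ℤP.pos-* a (suc n)) (ℤP.pos-* b (suc m))))

fromℕ : ℕ → ℚ
fromℕ n = (+ n) / 1

2ℚ 3ℚ : ℚ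
2ℚ = fromℕ 2
3ℚ = fromℕ 3

fromℕ-+ : ∀ a b → fromℕ (a ℕ.+ b) ≡ fromℕ a + fromℕ b
fromℕ-+ a b = trans (/-≡ (a ℕ.+ b) (a ℕ.* 1 ℕ.+ b ℕ.* 1) 1 1 (cross a b)) (sym (/-+ a b 1 1))
  where
  cross : ∀ a b → (a ℕ.+ b) ℕ.* 1 ≡ (a ℕ.* 1 ℕ.+ b ℕ.* 1) ℕ.* 1
  cross = solve-∀

fromℕ-* : ∀ a b → fromℕ (a ℕ.* b) ≡ fromℕ a * fromℕ b
fromℕ-* a b = trans (/-≡ (a ℕ.* b) (a ℕ.* b) 1 1 refl) (sym (/-* a b 1 1))

fromℕ-suc : ∀ n → fromℕ (suc n) ≡ fromℕ n + 1ℚ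
fromℕ-suc n = trans (cong fromℕ (ℕP.+-comm 1 n)) (fromℕ-+ n 1)

fromℕ-half : ∀ a → (+ a) / 2 ≡ fromℕ a * ½
fromℕ-half a = trans (/-≡ a (a ℕ.* 1) 2 2 (cross a)) (sym (/-* a 1 1 2))
  where
  cross : ∀ a → a ℕ.* 2 ≡ a ℕ.* 1 ℕ.* 2
  cross = solve-∀

fromℕ-*-invPow : ∀ j → fromℕ (suc j) * invPow (suc j) 1 ≡ 1ℚ
fromℕ-*-invPow j = trans (/-* (suc j) 1 1 (suc j ℕ.^ 1)) (/-≡ (suc j ℕ.* 1) 1 (1 ℕ.* (suc j ℕ.^ 1)) 1 (cross (suc j)))
  where
  -- note  m ^ 1  unfolds to  m * 1
  cross : ∀ m → m ℕ.* 1 ℕ.* 1 ≡ 1 ℕ.* (1 ℕ.* (m ℕ.* 1))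
  cross = solve-∀

-- 1/k^(s+t) = 1/k^s · 1/k^t  (also for the dummy value invPow 0 = 0).
invPow-+ : ∀ k s t → invPow k (s ℕ.+ t) ≡ invPow k s * invPow k t
invPow-+ zero s t = refl
invPow-+ (suc j) s t = sym (trans (/-* 1 1 (m ℕ.^ s) (m ℕ.^ t)) (/-≡ 1 1 (m ℕ.^ s ℕ.* m ℕ.^ t) (m ℕ.^ (s ℕ.+ t)) {{ℕP.m*n≢0 (m ℕ.^ s) (m ℕ.^ t)}} cross))
  where
  m : ℕ
  m = suc j
  instance
    ms≢0 : NonZero (m ℕ.^ s)
    ms≢0 = ℕP.m^n≢0 m s
    mt≢0 : NonZero (m ℕ.^ t)
    mt≢0 = ℕP.m^n≢0 m t
    ms+t≢0 : NonZero (m ℕ.^ (s ℕ.+ t))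
    ms+t≢0 = ℕP.m^n≢0 m (s ℕ.+ t)
  cross : 1 ℕ.* (m ℕ.^ (s ℕ.+ t)) ≡ 1 ℕ.* (m ℕ.^ s ℕ.* m ℕ.^ t)
  cross = cong (1 ℕ.*_) (ℕP.^-distribˡ-+-* m s t)

sumTo-cong : ∀ n {f g : ℕ → ℚ} → (∀ k → k ℕ.≤ n → f k ≡ g k) → sumTo n f ≡ sumTo n g
sumTo-cong zero    f≗g = refl
sumTo-cong (suc n) f≗g = cong₂ _+_ (sumTo-cong n (λ k k≤n → f≗g k (ℕP.m≤n⇒m≤1+n k≤n))) (f≗g (suc n) ℕP.≤-refl)

sumTo-+ : ∀ n (f g : ℕ → ℚ) → sumTo n (λ k → f k + g k) ≡ sumTo n f + sumTo n g
sumTo-+ zero    f g = refl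
sumTo-+ (suc n) f g = trans (cong (_+ (f (suc n) + g (suc n))) (sumTo-+ n f g))
  (+-interchange (sumTo n f) (sumTo n g) (f (suc n)) (g (suc n)))
  where open CommSemigroupProperties (CommutativeMonoid.commutativeSemigroup QP.+-0-commutativeMonoid) renaming (interchange to +-interchange)

sumTo-*ʳ : ∀ n (f : ℕ → ℚ) c → sumTo n (λ k → f k * c) ≡ sumTo n f * c
sumTo-*ʳ zero    f c = sym (QP.*-zeroˡ c)
sumTo-*ʳ (suc n) f c = trans (cong (_+ (f (suc n) * c)) (sumTo-*ʳ n f c)) (sym (QP.*-distribʳ-+ c (sumTo n f) (f (suc n))))

sumBetween-step : ∀ m n (f : ℕ → ℚ) → m ℕ.≤ n → sumBetween m (suc n) f ≡ sumBetween m n f + f (suc n)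
sumBetween-step m n f m≤n = begin
  sumTo (suc n ∸ m) g                 ≡⟨ cong (λ l → sumTo l g) (ℕP.+-∸-assoc 1 m≤n) ⟩
  sumTo (n ∸ m) g + f (m ℕ.+ suc (n ∸ m)) ≡⟨ cong (λ i → sumTo (n ∸ m) g + f i) last-index ⟩
  sumTo (n ∸ m) g + f (suc n)          ∎
  where
  open ≡-Reasoning
  g : ℕ → ℚ
  g i = f (m ℕ.+ i)
  last-index : m ℕ.+ suc (n ∸ m) ≡ suc n
  last-index = trans (ℕP.+-suc m (n ∸ m)) (cong suc (ℕP.m+[n∸m]≡n m≤n))

sumBetween-empty : ∀ n (f : ℕ → ℚ) → sumBetween n n f ≡ 0ℚ
sumBetween-empty n f = cong (λ l → sumTo l (λ i → f (n ℕ.+ i))) (ℕP.n∸n≡0 n)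

tailSum-depth1-step : ∀ k n s → k ℕ.≤ n → tailSum k (suc n) (s ∷ []) ≡ tailSum k n (s ∷ []) + invPow (suc n) s
tailSum-depth1-step k n s k≤n =
  trans (sumBetween-step k n (λ i → invPow i s * 1ℚ) k≤n) (cong (_+_ (tailSum k n (s ∷ []))) (QP.*-identityʳ _))

H-depth1-step : ∀ n s → H (suc n) (s ∷ []) ≡ H n (s ∷ []) + invPow (suc n) s
H-depth1-step n s = tailSum-depth1-step 0 n s ℕ.z≤n

-- Depth-two recurrence  H_{n+1}(s,t) = H_n(s,t) + H_n(s) / (n+1)^t:
-- a new pair k₁ < k₂ ≤ n+1 either has k₂ ≤ n or k₂ = n+1 (and k₁ = n+1 is
-- impossible since the inner range is then empty).
H-depth2-step : ∀ n s t → H (suc n) (s ∷ t ∷ []) ≡ H n (s ∷ t ∷ []) + H n (s ∷ []) * invPow (suc n) t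
H-depth2-step n s t = begin
  sumTo n (λ k → a k * T k (suc n)) + a (suc n) * T (suc n) (suc n)
    ≡⟨ cong₂ _+_ (sumTo-cong n split) (cong (a (suc n) *_) (sumBetween-empty (suc n) (λ i → invPow i t * 1ℚ))) ⟩
  sumTo n (λ k → a k * T k n + (a k * 1ℚ) * y) + a (suc n) * 0ℚ
    ≡⟨ cong₂ _+_ (sumTo-+ n (λ k → a k * T k n) (λ k → (a k * 1ℚ) * y)) (QP.*-zeroʳ (a (suc n))) ⟩
  (H n (s ∷ t ∷ []) + sumTo n (λ k → (a k * 1ℚ) * y)) + 0ℚ
    ≡⟨ QP.+-identityʳ _ ⟩
  H n (s ∷ t ∷ []) + sumTo n (λ k → (a k * 1ℚ) * y)
    ≡⟨ cong (_+_ (H n (s ∷ t ∷ []))) (sumTo-*ʳ n (λ k → a k * 1ℚ) y) ⟩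
  H n (s ∷ t ∷ []) + H n (s ∷ []) * y ∎
  where
  open ≡-Reasoning
  a : ℕ → ℚ
  a k = invPow k s
  T : ℕ → ℕ → ℚ
  T k m = tailSum k m (t ∷ [])
  y : ℚ
  y = invPow (suc n) t
  split : ∀ k → k ℕ.≤ n → a k * T k (suc n) ≡ a k * T k n + (a k * 1ℚ) * y
  split k k≤n = begin
    a k * T k (suc n)          ≡⟨ cong (a k *_) (tailSum-depth1-step k n t k≤n) ⟩
    a k * (T k n + y)          ≡⟨ QP.*-distribˡ-+ (a k) (T k n) y ⟩
    a k * T k n + a k * y      ≡⟨ cong (λ u → a k * T k n + u * y) (sym (QP.*-identityʳ (a k))) ⟩
    a k * T k n + (a k * 1ℚ) * y ∎

square-step : ∀ h y q A → h * h ≡ q + 2ℚ * A → (h + y) * (h + y) ≡ (q + y * y) + 2ℚ * (A + h * y)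
square-step h y q A h²≡q+2A = begin
  (h + y) * (h + y)                     ≡⟨ solve 2 (λ h y → (h :+ y) :* (h :+ y) := h :* h :+ (con 2ℚ :* (h :* y) :+ y :* y)) refl h y ⟩
  h * h + (2ℚ * (h * y) + y * y)         ≡⟨ cong (_+ (2ℚ * (h * y) + y * y)) h²≡q+2A ⟩
  (q + 2ℚ * A) + (2ℚ * (h * y) + y * y)   ≡⟨ solve 4 (λ h y q A → (q :+ con 2ℚ :* A) :+ (con 2ℚ :* (h :* y) :+ y :* y) := (q :+ y :* y) :+ con 2ℚ :* (A :+ h :* y)) refl h y q A ⟩
  (q + y * y) + 2ℚ * (A + h * y)           ∎
  where open ≡-Reasoning; open ℚ-Solver

H-square : ∀ n s → H n (s ∷ []) * H n (s ∷ []) ≡ H n ((s ℕ.+ s) ∷ []) + 2ℚ * H n (s ∷ s ∷ [])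
H-square zero    s = refl
H-square (suc n) s = begin
  H (suc n) (s ∷ []) * H (suc n) (s ∷ [])
    ≡⟨ cong₂ _*_ (H-depth1-step n s) (H-depth1-step n s) ⟩
  (H n (s ∷ []) + y) * (H n (s ∷ []) + y)
    ≡⟨ square-step (H n (s ∷ [])) y (H n ((s ℕ.+ s) ∷ [])) (H n (s ∷ s ∷ [])) (H-square n s) ⟩
  (H n ((s ℕ.+ s) ∷ []) + y * y) + 2ℚ * (H n (s ∷ s ∷ []) + H n (s ∷ []) * y)
    ≡⟨ cong₂ (λ u v → u + 2ℚ * v) (sym square-term) (sym (H-depth2-step n s s)) ⟩
  H (suc n) ((s ℕ.+ s) ∷ []) + 2ℚ * H (suc n) (s ∷ s ∷ []) ∎
  where
  open ≡-Reasoning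
  y : ℚ
  y = invPow (suc n) s
  square-term : H (suc n) ((s ℕ.+ s) ∷ []) ≡ H n ((s ℕ.+ s) ∷ []) + y * y
  square-term = trans (H-depth1-step n (s ℕ.+ s)) (cong (_+_ (H n ((s ℕ.+ s) ∷ []))) (invPow-+ (suc n) s s))

closedForm : ℚ → ℚ → ℚ → ℚ → ℚ
closedForm N a b c = (N + 1ℚ) * a * b + (3ℚ * N + 1ℚ) * (a - ½ * (a * a)) + (N + 1ℚ) * ½ * c - 3ℚ * N

-- Polynomial identity behind the induction step: the increment of the closed
-- form equals the new summand (a+y)(b+ay) plus multiples of the two
-- expressions  c + 2b - a²  and  (N+1)y - 1,  which vanish in our situation.
closedForm-increment : ∀ N a b c y →
  closedForm (N + 1ℚ) (a + y) (b + a * y) (c + y * y)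
    ≡ closedForm N a b c + (a + y) * (b + a * y)
      + ½ * (c + 2ℚ * b - a * a) + (a * a + b + a * y + 3ℚ - 3ℚ * a - y) * ((N + 1ℚ) * y - 1ℚ)
closedForm-increment = solve 5 (λ N a b c y →
     F (N :+ con 1ℚ) (a :+ y) (b :+ a :* y) (c :+ y :* y)
  := F N a b c :+ (a :+ y) :* (b :+ a :* y)
     :+ con ½ :* (c :+ con 2ℚ :* b :- a :* a) :+ (a :* a :+ b :+ a :* y :+ con 3ℚ :- con 3ℚ :* a :- y) :* ((N :+ con 1ℚ) :* y :- con 1ℚ)) refl
  where
  open ℚ-Solver
  F : ∀ {k} → Polynomial k → Polynomial k → Polynomial k → Polynomial k → Polynomial k
  F N a b c = (N :+ con 1ℚ) :* a :* b :+ (con 3ℚ :* N :+ con 1ℚ) :* (a :- con ½ :* (a :* a)) :+ (N :+ con 1ℚ) :* con ½ :* c :- con 3ℚ :* N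

closedForm-step : ∀ N a b c y → (N + 1ℚ) * y ≡ 1ℚ → a * a ≡ c + 2ℚ * b →
  closedForm (N + 1ℚ) (a + y) (b + a * y) (c + y * y) ≡ closedForm N a b c + (a + y) * (b + a * y)
closedForm-step N a b c y [N+1]y≡1 a²≡c+2b = begin
  closedForm (N + 1ℚ) (a + y) (b + a * y) (c + y * y)
    ≡⟨ closedForm-increment N a b c y ⟩
  S + ½ * (c + 2ℚ * b - a * a) + P * ((N + 1ℚ) * y - 1ℚ)
    ≡⟨ cong₂ (λ u v → S + ½ * u + P * v) (u≡v⇒u-v≡0 (sym a²≡c+2b)) (u≡v⇒u-v≡0 [N+1]y≡1) ⟩
  S + ½ * 0ℚ + P * 0ℚ
    ≡⟨ solve 2 (λ S P → S :+ con ½ :* con 0ℚ :+ P :* con 0ℚ := S) refl S P ⟩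
  S ∎
  where
  open ≡-Reasoning
  open ℚ-Solver
  S P : ℚ
  S = closedForm N a b c + (a + y) * (b + a * y)
  P = a * a + b + a * y + 3ℚ - 3ℚ * a - y
  u≡v⇒u-v≡0 : ∀ {u v} → u ≡ v → u - v ≡ 0ℚ
  u≡v⇒u-v≡0 {u} refl = QP.+-inverseʳ u

sum-closedForm : ∀ n → sumTo n (λ k → H k (1 ∷ []) * H k (1 ∷ 1 ∷ []))
                         ≡ closedForm (fromℕ n) (H n (1 ∷ [])) (H n (1 ∷ 1 ∷ [])) (H n (2 ∷ []))
sum-closedForm zero    = refl
sum-closedForm (suc n) = begin
  sumTo n (λ k → h k * A k) + h (suc n) * A (suc n)
    ≡⟨ cong₂ _+_ (sum-closedForm n) (cong₂ _*_ (H-depth1-step n 1) (H-depth2-step n 1 1)) ⟩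
  closedForm (fromℕ n) (h n) (A n) (q n) + (h n + y) * (A n + h n * y)
    ≡⟨ closedForm-step (fromℕ n) (h n) (A n) (q n) y [n+1]y≡1 (H-square n 1) ⟨
  closedForm (fromℕ n + 1ℚ) (h n + y) (A n + h n * y) (q n + y * y)
    ≡⟨ cong₂ (λ N c → closedForm N (h n + y) (A n + h n * y) c) (sym (fromℕ-suc n)) (sym q-step) ⟩
  closedForm (fromℕ (suc n)) (h n + y) (A n + h n * y) (q (suc n))
    ≡⟨ cong₂ (λ a b → closedForm (fromℕ (suc n)) a b (q (suc n))) (sym (H-depth1-step n 1)) (sym (H-depth2-step n 1 1)) ⟩
  closedForm (fromℕ (suc n)) (h (suc n)) (A (suc n)) (q (suc n)) ∎
  where
  open ≡-Reasoning
  h A q : ℕ → ℚ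
  h k = H k (1 ∷ [])
  A k = H k (1 ∷ 1 ∷ [])
  q k = H k (2 ∷ [])
  y : ℚ
  y = invPow (suc n) 1
  [n+1]y≡1 : (fromℕ n + 1ℚ) * y ≡ 1ℚ
  [n+1]y≡1 = trans (cong (_* y) (sym (fromℕ-suc n))) (fromℕ-*-invPow n)
  q-step : q (suc n) ≡ q n + y * y
  q-step = trans (H-depth1-step n 2) (cong (_+_ (q n)) (invPow-+ (suc n) 1 1))

closedForm-fromℕ : ∀ n a b c →
  fromℕ (n ℕ.+ 1) * a * b + fromℕ (3 ℕ.* n ℕ.+ 1) * (a - ½ * (a * a)) + ((+ (n ℕ.+ 1)) / 2) * c - fromℕ (3 ℕ.* n)
    ≡ closedForm (fromℕ n) a b c
closedForm-fromℕ n a b c =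
  cong₂ _-_ (cong₂ _+_ (cong₂ _+_ (cong (λ N → N * a * b) n+1) (cong (λ M → M * (a - ½ * (a * a))) 3n+1))
                       (cong (_* c) (trans (fromℕ-half (n ℕ.+ 1)) (cong (_* ½) n+1))))
            (fromℕ-* 3 n)
  where
  n+1 : fromℕ (n ℕ.+ 1) ≡ fromℕ n + 1ℚ
  n+1 = fromℕ-+ n 1
  3n+1 : fromℕ (3 ℕ.* n ℕ.+ 1) ≡ 3ℚ * fromℕ n + 1ℚ
  3n+1 = trans (fromℕ-+ (3 ℕ.* n) 1) (cong (_+ 1ℚ) (fromℕ-* 3 n))

-- The identity holds for every n (for n = 0 both sides vanish).
mainTheorem5 : (n : ℕ) → 1 Data.Nat.≤ n →
    sumTo n (λ k → H k (1 ∷ []) * H k (1 ∷ 1 ∷ []))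
      ≡ ((+ (n Data.Nat.+ 1)) / 1) * H n (1 ∷ []) * H n (1 ∷ 1 ∷ [])
        + ((+ (3 Data.Nat.* n Data.Nat.+ 1)) / 1) * (H n (1 ∷ []) - ½ * (H n (1 ∷ []) * H n (1 ∷ [])))
        + ((+ (n Data.Nat.+ 1)) / 2) * H n (2 ∷ [])
        - ((+ (3 Data.Nat.* n)) / 1)
mainTheorem5 n _ = trans (sum-closedForm n) (sym (closedForm-fromℕ n (H n (1 ∷ [])) (H n (1 ∷ 1 ∷ [])) (H n (2 ∷ []))))
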